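{- Let $(\mathbb P,\ell_{\mathbb P},c_{\mathbb P})$ be a $\Sigma$-Prikry triple, $\mathbb A=(A,\unlhd)$ a notion of forcing, $\ell_{\mathbb A}$ a function with domain $A$, and suppose $(\pitchfork,\pi)$ is a forking projection from $(\mathbb A,\ell_{\mathbb A})$ to $(\mathbb P,\ell_{\mathbb P})$. Let $a\in A$. Then: (1) $\pitchfork_a\restriction W(\pi(a))$ is a bijection from $W(\pi(a))$ onto $W(a)$; (2) for all $n<\omega$ and $r\le^n\pi(a)$, $\pitchfork_a(r)\in A^a_n$.
   Context: $\Sigma$-Prikry: Let $\Sigma=\langle\kappa_n\mid n<\omega\rangle$ be a non-decreasing sequence of regular uncountable cardinals converging to $\kappa$, $\mathbb P=(P,\le)$ a notion of forcing ($q\le p$: $q$ extends $p$) with greatest element $1$, $\mu$ a cardinal with $1\Vdash_{\mathbb P}\check\mu=(\check\kappa)^+$. For $\ell:P\to\omega$ and $c$ from $P$ into a set of size $\le\mu$, write $P_n:=\{p\mid\ell(p)=n\}$, $P^p_n:=\{q\le p\mid \ell(q)=\ell(p)+n\}$, $q\le^n p$ iff $q\in P^p_n$. $U$ is $0$-open iff ($r\in U\Leftrightarrow P^r_0\subseteq U$). $(\mathbb P,\ell,c)$ is $\Sigma$-Prikry iff: (S1) $\ell$ surjective, $q\le p\Rightarrow\ell(q)\ge\ell(p)$, each $p$ has $q\le p$ with $\ell(q)=\ell(p)+1$; (S2) each $\mathbb P_n:=(P_n\cup\{1\},\le)$ is $\kappa_n$-directed-closed; (S3) $c(p)=c(q)\Rightarrow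 P^p_0\cap P^q_0\neq\emptyset$; (S4) for $q\le^{n+m}p$, $\{r\le^n p\mid q\le^m r\}$ has a greatest element $m(p,q)$, $w(p,q):=0(p,q)$; (S5) $|W(p)|<\mu$ where $W(p):=\{w(p,q)\mid q\le p\}$; (S6) for $p'\le p$, $q\mapsto w(p,q)$ is order-preserving $W(p')\to W(p)$; (S7) for every $0$-open $U$, $p$, $n$ there is $q\le^0p$ with $P^q_n\cap U=\emptyset$ or $P^q_n\subseteq U$. For $\mathbb A=(A,\unlhd)$ and $\ell_{\mathbb A}$, define analogously $A^a_n:=\{b\unlhd a\mid\ell_{\mathbb A}(b)=\ell_{\mathbb A}(a)+n\}$, $b\unlhd^n a$ iff $b\in A^a_n$, $m(a,b)$ the greatest element of $\{d\in A^a_n\mid b\in A^d_m\}$ (if it exists), $w(a,b):=0(a,b)$, $W(a):=\{w(a,b)\mid b\unlhd a\}$; $\mathbb P{\downarrow}p$ and $\mathbb A{\downarrow}a$ denote the cones below $p$, $a$. Forking projection from $(\mathbb A,\ell_{\mathbb A})$ to $(\mathbb P,\ell_{\mathbb P})$: a pair $(\pitchfork,\pi)$ with (F1) $\pi:A\to P$ a projection (maps greatest element to greatest element, order-preserving, and for all $a$ and $p'\le\pi(a)$ there is $a'\unlhd a$ with $\pi(a')\le p'$) and $\ell_{\mathbb A}=\ell_{\mathbb P}\circ\pi$; (F2) each $\pitchfork_a$ is an order-preserving map from $\mathbb P{\downarrow}\pi(a)$ to $\mathbb A{\downarrow}a$; (F3) for each $p\in P$, $\{a\mid\pi(a)=p\}$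 has a greatest element $\lceil p\rceil^{\mathbb A}$; (F4) for all $n,m$ and $b\unlhd^{n+m}a$, $m(a,b)$ exists and equals $\pitchfork_a(m(\pi(a),\pi(b)))$; (F5) $\pi(\pitchfork_a(r))=r$ for $r\le\pi(a)$; (F6) for $r\le\pi(a)$: $a=\lceil\pi(a)\rceil^{\mathbb A}$ iff $\pitchfork_a(r)=\lceil r\rceil^{\mathbb A}$; (F7) for $a'\unlhd^0 a$ and $r\le^0\pi(a')$, $\pitchfork_{a'}(r)\unlhd\pitchfork_a(r)$. -}

module Defs where

open import Data.Nat using (ℕ; _+_) renaming (_≤_ to _≤ℕ_)
open import Data.Product using (Σ; _×_; _,_; proj₁; proj₂)
open import Data.Sum using (_⊎_)
open import Relation.Binary.PropositionalEquality using (_≡_)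
open import Relation.Nullary using (¬_)

-- A notion of forcing: a partial order (q ≤ p : q extends p) with a
-- greatest element 𝟙.

record Forcing : Set₁ where
  field
    Carrier   : Set
    _≤_       : Carrier → Carrier → Set
    ≤-refl    : ∀ {p} → p ≤ p
    ≤-trans   : ∀ {p q r} → p ≤ q → q ≤ r → p ≤ r
    ≤-antisym : ∀ {p q} → p ≤ q → q ≤ p → p ≡ q
    𝟙         : Carrier
    𝟙-max     : ∀ p → p ≤ 𝟙

module Graded (F : Forcing) (ℓ : Forcing.Carrier F → ℕ) where
  open Forcing F

  _≤[_]_ : Carrier → ℕ → Carrier → Set
  q ≤[ n ] p = (q ≤ p) × (ℓ q ≡ ℓ p + n)

  IsGreatest : (Carrier → Set) → Carrier → Set
  IsGreatest S x = S x × (∀ y → S y → y ≤ x)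

  MSet : ℕ → ℕ → Carrier → Carrier → Carrier → Set
  MSet n m p q r = (r ≤[ n ] p) × (q ≤[ m ] r)

  -- x = m(p,q)  (for q ≤^{n+m} p); here n is the first index
  IsM : ℕ → ℕ → Carrier → Carrier → Carrier → Set
  IsM n m p q x = IsGreatest (MSet n m p q) x

  IsW : Carrier → Carrier → Carrier → Set
  IsW p q x = Σ ℕ λ m → (q ≤[ 0 + m ] p) × IsM 0 m p q x

  InW : Carrier → Carrier → Set
  InW p x = Σ Carrier λ q → (q ≤ p) × IsW p q x

  InW⇒≤ : ∀ {p x} → InW p x → x ≤ p
  InW⇒≤ (q , _ , m , _ , (x≤⁰p , _) , _) = proj₁ x≤⁰p

  ZeroOpen : (Carrier → Set) → Set
  ZeroOpen U = ∀ r → (U r → ∀ q → q ≤[ 0 ] r → U q)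
                   × ((∀ q → q ≤[ 0 ] r → U q) → U r)

  InLevel∪𝟙 : ℕ → Carrier → Set
  InLevel∪𝟙 n p = (ℓ p ≡ n) ⊎ (p ≡ 𝟙)

-- BelowKappa n I  :  |I| < κ_n
--   BelowMu I       :  |I| < μ
--   AtMostMu I      :  |I| ≤ μ

record CardinalData : Set₁ where
  field
    BelowKappa : ℕ → Set → Set
    BelowMu    : Set → Set
    AtMostMu   : Set → Set

module SigmaPrikryDef (P : Forcing) (ℓ : Forcing.Carrier P → ℕ)
                      (K : CardinalData) where
  open Forcing P
  open Graded P ℓ
  open CardinalData K

  DirectedClosed : ℕ → Set₁
  DirectedClosed n =
    (I : Set) → BelowKappa n I → (D : I → Carrier) →
    (∀ i → InLevel∪𝟙 n (D i)) →
    (∀ i j → Σ I λ k → (D k ≤ D i) × (D k ≤ D j)) →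
    Σ Carrier λ b → InLevel∪𝟙 n b × (∀ i → b ≤ D i)

  record IsSigmaPrikry {C : Set} (c : Carrier → C) : Set₁ where
    field
      S1-surj  : ∀ n → Σ Carrier λ p → ℓ p ≡ n
      S1-mono  : ∀ {p q} → q ≤ p → ℓ p ≤ℕ ℓ q
      S1-step  : ∀ p → Σ Carrier λ q → (q ≤ p) × (ℓ q ≡ ℓ p + 1)
      S2       : ∀ n → DirectedClosed n
      c-size   : AtMostMu C
      S3       : ∀ p q → c p ≡ c q → Σ Carrier λ r → (r ≤[ 0 ] p) × (r ≤[ 0 ] q)
      S4       : ∀ n m p q → q ≤[ n + m ] p → Σ Carrier λ x → IsM n m p q x
      S5       : ∀ p → BelowMu (Σ Carrier (InW p))
      S6       : ∀ p p' → p' ≤ p → ∀ x y → InW p' x → InW p' y → x ≤ y →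
                 ∀ u v → IsW p x u → IsW p y v → u ≤ v
      S7       : ∀ (U : Carrier → Set) → ZeroOpen U → ∀ p n →
                 Σ Carrier λ q → (q ≤[ 0 ] p) ×
                   ((∀ s → s ≤[ n ] q → ¬ U s) ⊎ (∀ s → s ≤[ n ] q → U s))

module ForkingDef (P A : Forcing)
                  (ℓP : Forcing.Carrier P → ℕ) (ℓA : Forcing.Carrier A → ℕ) where
  open Forcing P using () renaming (Carrier to |P|; _≤_ to _≤P_; 𝟙 to 𝟙P)
  open Forcing A using () renaming (Carrier to |A|; _≤_ to _⊴_; 𝟙 to 𝟙A;
                                    ≤-trans to ⊴-trans)
  module GP = Graded P ℓP
  module GA = Graded A ℓA
  open Forcing P using (≤-trans)

  record ForkingProjection : Set where
    field
      π        : |A| → |P|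
      π-𝟙      : π 𝟙A ≡ 𝟙P
      π-mono   : ∀ {a b} → b ⊴ a → π b ≤P π a
      π-proj   : ∀ a p' → p' ≤P π a → Σ |A| λ a' → (a' ⊴ a) × (π a' ≤P p')
      ℓ-eq     : ∀ a → ℓA a ≡ ℓP (π a)
      ⋔        : (a : |A|) (r : |P|) → .(r ≤P π a) → |A|
      ⋔-below  : ∀ a r .(h : r ≤P π a) → ⋔ a r h ⊴ a
      ⋔-mono   : ∀ a r r' .(h : r ≤P π a) .(h' : r' ≤P π a) → r ≤P r' →
                 ⋔ a r h ⊴ ⋔ a r' h'
      ⌈_⌉      : |P| → |A|
      ⌈⌉-great : ∀ p → GA.IsGreatest (λ a → π a ≡ p) ⌈ p ⌉
      F4       : ∀ n m a b → b GA.≤[ n + m ] a →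
                 Σ |P| λ x → Σ (GP.IsM n m (π a) (π b) x) λ h →
                   GA.IsM n m a b (⋔ a x (proj₁ (proj₁ (proj₁ h))))
      F5       : ∀ a r .(h : r ≤P π a) → π (⋔ a r h) ≡ r
      F6       : ∀ a r .(h : r ≤P π a) →
                 (a ≡ ⌈ π a ⌉ → ⋔ a r h ≡ ⌈ r ⌉) × (⋔ a r h ≡ ⌈ r ⌉ → a ≡ ⌈ π a ⌉)
      F7       : ∀ a a' (h : a' GA.≤[ 0 ] a) r (hr : r GP.≤[ 0 ] π a') →
                 ⋔ a' r (proj₁ hr) ⊴ ⋔ a r (≤-trans (proj₁ hr) (π-mono (proj₁ h)))

  Part1 : ForkingProjection → |A| → Set
  Part1 fp a =
      (∀ x (hx : GP.InW (π a) x) → GA.InW a (⋔ a x (GP.InW⇒≤ hx)))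
    × (∀ x y (hx : GP.InW (π a) x) (hy : GP.InW (π a) y) →
         ⋔ a x (GP.InW⇒≤ hx) ≡ ⋔ a y (GP.InW⇒≤ hy) → x ≡ y)
    × (∀ y → GA.InW a y →
         Σ |P| λ x → Σ (GP.InW (π a) x) λ hx → ⋔ a x (GP.InW⇒≤ hx) ≡ y)
    where open ForkingProjection fp

  Part2 : ForkingProjection → |A| → Set
  Part2 fp a = ∀ n r (h : r GP.≤[ n ] π a) → ⋔ a r (proj₁ h) GA.≤[ n ] a
    where open ForkingProjection fp

module Submission where

-- The proof uses only (F1), (F2), (F4) and (F5).
--     Consequently ⋔_a maps P^{π a}_n into A^a_n (part (2)), and π maps
--     A^a_n into P^{π a}_n.
--   * ⋔_a is injective, again since π is a left inverse (F5).
--   * (F4) with n = 0 says w(a,b) = ⋔_a(w(π a, π b)).  Applied to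
--     b = ⋔_a(q) this gives ⋔_a(w(π a, q)) = w(a, ⋔_a q), so ⋔_a maps
--     W(π a) into W(a); applied to an arbitrary b ⊴ a it shows that every
--     element of W(a) is the image of w(π a, π b) ∈ W(π a).

open import Defs
open import Data.Nat using (ℕ; _+_)
open import Data.Product using (_×_; Σ; _,_; proj₁; proj₂)
open import Relation.Binary.PropositionalEquality

greatest-unique : (F : Forcing) (ℓ : Forcing.Carrier F → ℕ) →
                  ∀ {S x y} → Graded.IsGreatest F ℓ S x →
                  Graded.IsGreatest F ℓ S y → x ≡ y
greatest-unique F ℓ (x∈S , x-max) (y∈S , y-max) =
  Forcing.≤-antisym F (y-max _ x∈S) (x-max _ y∈S)

module ForkingFacts (P A : Forcing)
                    (ℓP : Forcing.Carrier P → ℕ) (ℓA : Forcing.Carrier A → ℕ)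
                    (fp : ForkingDef.ForkingProjection P A ℓP ℓA) where
  open ForkingDef P A ℓP ℓA
  open ForkingProjection fp
  open Forcing P using () renaming (Carrier to |P|; _≤_ to _≤P_)

  ℓ-⋔ : ∀ a r .(h : r ≤P π a) → ℓA (⋔ a r h) ≡ ℓP r
  ℓ-⋔ a r h = begin
    ℓA (⋔ a r h)      ≡⟨ ℓ-eq (⋔ a r h) ⟩
    ℓP (π (⋔ a r h))  ≡⟨ cong ℓP (F5 a r h) ⟩
    ℓP r              ∎
    where open ≡-Reasoning

  ⋔-graded : ∀ a → Part2 fp a
  ⋔-graded a n r (r≤πa , ℓr) = ⋔-below a r r≤πa , (begin
    ℓA (⋔ a r r≤πa)  ≡⟨ ℓ-⋔ a r r≤πa ⟩
    ℓP r             ≡⟨ ℓr ⟩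
    ℓP (π a) + n     ≡⟨ cong (_+ n) (ℓ-eq a) ⟨
    ℓA a + n         ∎)
    where open ≡-Reasoning

  π-graded : ∀ {a b n} → b GA.≤[ n ] a → π b GP.≤[ n ] π a
  π-graded {a} {b} {n} (b⊴a , ℓb) = π-mono b⊴a , (begin
    ℓP (π b)      ≡⟨ ℓ-eq b ⟨
    ℓA b          ≡⟨ ℓb ⟩
    ℓA a + n      ≡⟨ cong (_+ n) (ℓ-eq a) ⟩
    ℓP (π a) + n  ∎)
    where open ≡-Reasoning

  ⋔-cong : ∀ a {x y} .(hx : x ≤P π a) .(hy : y ≤P π a) →
           x ≡ y → ⋔ a x hx ≡ ⋔ a y hy
  ⋔-cong a hx hy refl = refl

  -- ⋔_a is injective, since π ∘ ⋔_a = id.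
  ⋔-injective : ∀ a x y .(hx : x ≤P π a) .(hy : y ≤P π a) →
                ⋔ a x hx ≡ ⋔ a y hy → x ≡ y
  ⋔-injective a x y hx hy e = begin
    x               ≡⟨ F5 a x hx ⟨
    π (⋔ a x hx)    ≡⟨ cong π e ⟩
    π (⋔ a y hy)    ≡⟨ F5 a y hy ⟩
    y               ∎
    where open ≡-Reasoning

  -- ⋔_a commutes with w:  w(π a, q) = x  implies  w(a, ⋔_a q) = ⋔_a x.
  -- By (F4), w(a, ⋔_a q) = ⋔_a x' with x' = w(π a, π(⋔_a q)) = w(π a, q) = x.
  ⋔-preserves-w : ∀ a q x (q≤πa : q ≤P π a) (hx : GP.IsW (π a) q x)
                    .(x≤πa : x ≤P π a) →
                  GA.IsW a (⋔ a q q≤πa) (⋔ a x x≤πa)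
  ⋔-preserves-w a q x q≤πa (m , q≤ᵐπa , x-is-w) x≤πa =
    m , b≤ᵐa , subst (GA.IsM 0 m a b) (⋔-cong a _ x≤πa x'≡x) x'-lifts
    where
    b : Forcing.Carrier A
    b = ⋔ a q q≤πa
    b≤ᵐa : b GA.≤[ m ] a
    b≤ᵐa = ⋔-graded a m q q≤ᵐπa
    x' : |P|
    x' = proj₁ (F4 0 m a b b≤ᵐa)
    x'-is-w-of-πb : GP.IsM 0 m (π a) (π b) x'
    x'-is-w-of-πb = proj₁ (proj₂ (F4 0 m a b b≤ᵐa))
    x'-lifts : GA.IsM 0 m a b (⋔ a x' (proj₁ (proj₁ (proj₁ x'-is-w-of-πb))))
    x'-lifts = proj₂ (proj₂ (F4 0 m a b b≤ᵐa))
    x'-is-w : GP.IsM 0 m (π a) q x'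
    x'-is-w = subst (λ z → GP.IsM 0 m (π a) z x') (F5 a q q≤πa) x'-is-w-of-πb
    x'≡x : x' ≡ x
    x'≡x = greatest-unique P ℓP x'-is-w x-is-w

  -- Every element of W(a) lies in the image of W(π a) under ⋔_a:
  -- by (F4), w(a,b) = ⋔_a(w(π a, π b)).
  W-covered : ∀ a y → GA.InW a y →
              Σ |P| λ x → Σ (GP.InW (π a) x) λ hx → ⋔ a x (GP.InW⇒≤ hx) ≡ y
  W-covered a y (b , b⊴a , m , b≤ᵐa , y-is-w) =
    x , (π b , π-mono b⊴a , m , π-graded b≤ᵐa , x-is-w) ,
    greatest-unique A ℓA x-lifts y-is-w
    where
    x : |P|
    x = proj₁ (F4 0 m a b b≤ᵐa)
    x-is-w : GP.IsM 0 m (π a) (π b) x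
    x-is-w = proj₁ (proj₂ (F4 0 m a b b≤ᵐa))
    x-lifts : GA.IsM 0 m a b (⋔ a x (proj₁ (proj₁ (proj₁ x-is-w))))
    x-lifts = proj₂ (proj₂ (F4 0 m a b b≤ᵐa))

  ⋔-W-bijection : ∀ a → Part1 fp a
  ⋔-W-bijection a = maps-into , injective , W-covered a
    where
    maps-into : ∀ x (hx : GP.InW (π a) x) → GA.InW a (⋔ a x (GP.InW⇒≤ hx))
    maps-into x (q , q≤πa , w-eq) =
      ⋔ a q q≤πa , ⋔-below a q q≤πa , ⋔-preserves-w a q x q≤πa w-eq _
    injective : ∀ x y (hx : GP.InW (π a) x) (hy : GP.InW (π a) y) →
                ⋔ a x (GP.InW⇒≤ hx) ≡ ⋔ a y (GP.InW⇒≤ hy) → x ≡ y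
    injective x y hx hy = ⋔-injective a x y (GP.InW⇒≤ hx) (GP.InW⇒≤ hy)

lemma4p3 : (K : CardinalData) (P : Forcing) (ℓP : Forcing.Carrier P → ℕ)
           {C : Set} (cP : Forcing.Carrier P → C) →
           SigmaPrikryDef.IsSigmaPrikry P ℓP K cP →
           (A : Forcing) (ℓA : Forcing.Carrier A → ℕ) →
           (fp : ForkingDef.ForkingProjection P A ℓP ℓA) →
           (a : Forcing.Carrier A) →
           ForkingDef.Part1 P A ℓP ℓA fp a × ForkingDef.Part2 P A ℓP ℓA fp a
lemma4p3 K P ℓP cP _ A ℓA fp a = ⋔-W-bijection a , ⋔-graded a
  where open ForkingFacts P A ℓP ℓA fp
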